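{- Let $G=(V,E)$ be a simple undirected graph, let $S\subseteq\binom{V}{2}$ be a set of terminal pairs, and let $a^{\mathsf T}x\geq b$ be facet-defining for $\mathrm{MultC}(G,S)$ with $\{x:a^{\mathsf T}x\geq b\}\neq\{x:x_{e'}\geq 0\}$ for all $e'\in E$. Let $P\subseteq G$ be an induced path (i.e., every internal node of $P$ has degree $2$ in $G$) such that no internal node of $P$ is a terminal. Then $a_e=a_f$ for all $e,f\in E(P)$.
   Context: Given a graph $G=(V,E)$ and $S\subseteq\binom{V}{2}$, an ($S$-)multicut is a set $\delta\subseteq E$ such that for every $\{s,t\}\in S$ the nodes $s$ and $t$ lie in different components of $G-\delta$. A node $v$ is a terminal if $\{v,w\}\in S$ for some $w$. For $F\subseteq E$, $x^F\in\mathbb{R}^E$ is its incidence vector. The multicut dominant is $\mathrm{MultC}(G,S)=\mathrm{conv}\{x^\delta:\delta \text{ an } S\text{ -multicut}\}+\mathbb{R}^E_{\geq 0}$.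
   Formalization: The coefficients a and b are rational, and MultC(G,S), its faces and the halfspaces are taken as sets of points of ℚ^E rather than ℝ^E. -}

module Defs where

open import Data.Nat using (ℕ; zero; suc)
open import Data.Fin using (Fin; zero; suc; inject₁; toℕ)
open import Data.Fin.Properties using (_≟_)
open import Data.Product using (Σ; ∃; ∃-syntax; _×_; _,_)
open import Data.Sum using (_⊎_)
open import Data.Bool using (Bool; true; false)
open import Data.List using (List; length; filter; allFin)
open import Data.List.Membership.Propositional using (_∈_)
open import Data.Rational using (ℚ; 0ℚ; 1ℚ; _+_; _*_; _≤_)
open import Relation.Binary.PropositionalEquality using (_≡_; _≢_)
open import Relation.Nullary using (¬_)
open import Relation.Nullary.Decidable using (_⊎-dec_)
open import Function using (_⇔_)

-- Simple undirected graphs on vertex set Fin n with edge set Fin m.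
-- Edge e has end-nodes (src e) and (tgt e) (orientation irrelevant).

record Graph : Set where
  field
    n   : ℕ
    m   : ℕ
    src : Fin m → Fin n
    tgt : Fin m → Fin n
    noLoop  : ∀ e → src e ≢ tgt e
    noParallel : ∀ e f →
      ((src e ≡ src f × tgt e ≡ tgt f) ⊎ (src e ≡ tgt f × tgt e ≡ src f)) → e ≡ f

open Graph public

Joins : (G : Graph) → Fin (m G) → Fin (n G) → Fin (n G) → Set
Joins G e u v = (src G e ≡ u × tgt G e ≡ v) ⊎ (src G e ≡ v × tgt G e ≡ u)

degree : (G : Graph) → Fin (n G) → ℕ
degree G v = length (filter (λ e → (src G e ≟ v) ⊎-dec (tgt G e ≟ v)) (allFin (m G)))

TerminalPairs : Graph → Set
TerminalPairs G = List (Σ (Fin (n G) × Fin (n G)) λ { (s , t) → s ≢ t })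

IsTerminal : (G : Graph) → TerminalPairs G → Fin (n G) → Set
IsTerminal G S v = ∃[ p ] (p ∈ S × (Data.Product.proj₁ (Data.Product.proj₁ p) ≡ v
                                   ⊎ Data.Product.proj₂ (Data.Product.proj₁ p) ≡ v))

EdgeSet : Graph → Set
EdgeSet G = Fin (m G) → Bool

-- u and v lie in the same component of G - δ
data Connected (G : Graph) (δ : EdgeSet G) : Fin (n G) → Fin (n G) → Set where
  here : ∀ {u} → Connected G δ u u
  step : ∀ {u w v} (e : Fin (m G)) → δ e ≡ false → Joins G e u w →
         Connected G δ w v → Connected G δ u v

IsMulticut : (G : Graph) → TerminalPairs G → EdgeSet G → Set
IsMulticut G S δ = ∀ p → p ∈ S →
  ¬ Connected G δ (Data.Product.proj₁ (Data.Product.proj₁ p))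
                  (Data.Product.proj₂ (Data.Product.proj₁ p))

sumℚ : ∀ {k} → (Fin k → ℚ) → ℚ
sumℚ {zero}  f = 0ℚ
sumℚ {suc k} f = f zero + sumℚ (λ i → f (suc i))

dot : ∀ {k} → (Fin k → ℚ) → (Fin k → ℚ) → ℚ
dot a x = sumℚ (λ i → a i * x i)

incidence : ∀ {k} → (Fin k → Bool) → Fin k → ℚ
incidence F e with F e
... | true  = 1ℚ
... | false = 0ℚ

-- x ∈ MultC(G,S) = conv{x^δ : δ multicut} + ℝ^E_{≥0}
InMultC : (G : Graph) → TerminalPairs G → (Fin (m G) → ℚ) → Set
InMultC G S x =
  ∃[ k ] Σ (Fin k → ℚ) λ λs → Σ (Fin k → EdgeSet G) λ δs →
    (∀ i → 0ℚ ≤ λs i) × sumℚ λs ≡ 1ℚ × (∀ i → IsMulticut G S (δs i)) ×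
    (∀ e → sumℚ (λ i → λs i * incidence (δs i) e) ≤ x e)

AffinelyIndependent : ∀ {d k} → (Fin k → (Fin d → ℚ)) → Set
AffinelyIndependent {d} {k} p = ∀ (μ : Fin k → ℚ) → sumℚ μ ≡ 0ℚ →
  (∀ e → sumℚ (λ i → μ i * p i e) ≡ 0ℚ) → ∀ i → μ i ≡ 0ℚ

HasAffIndep : ∀ {d} → ((Fin d → ℚ) → Set) → ℕ → Set
HasAffIndep {d} P k = Σ (Fin k → (Fin d → ℚ)) λ p → (∀ i → P (p i)) × AffinelyIndependent p

-- dim P = k - 1, i.e. the maximum number of affinely independent points of P is k
-- (encoded as: DimPlus1 P k)
DimPlus1 : ∀ {d} → ((Fin d → ℚ) → Set) → ℕ → Set
DimPlus1 P k = HasAffIndep P k × ¬ HasAffIndep P (suc k)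

Valid : ∀ {d} → ((Fin d → ℚ) → Set) → (Fin d → ℚ) → ℚ → Set
Valid P a b = ∀ x → P x → b ≤ dot a x

Face : ∀ {d} → ((Fin d → ℚ) → Set) → (Fin d → ℚ) → ℚ → (Fin d → ℚ) → Set
Face P a b x = P x × dot a x ≡ b

FacetDefining : ∀ {d} → ((Fin d → ℚ) → Set) → (Fin d → ℚ) → ℚ → Set
FacetDefining P a b = Valid P a b ×
  ∃[ k ] (DimPlus1 P (suc k) × DimPlus1 (Face P a b) k)

SameAsNonneg : ∀ {d} → (Fin d → ℚ) → ℚ → Fin d → Set
SameAsNonneg a b e = ∀ x → (b ≤ dot a x) ⇔ (0ℚ ≤ x e)

record Path (G : Graph) : Set where
  field
    len   : ℕ
    nodes : Fin (suc len) → Fin (n G)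
    edges : Fin len → Fin (m G)
    nodesDistinct : ∀ i j → nodes i ≡ nodes j → i ≡ j
    edgeJoins : ∀ i → Joins G (edges i) (nodes (inject₁ i)) (nodes (suc i))

open Path public

Internal : ∀ {G} (P : Path G) → Fin (suc (len P)) → Set
Internal P i = (i ≢ zero) × (toℕ i ≢ len P)

-- Let e, f be the two edges at an internal node v of the path, and suppose a e < a f.  In
-- G − (δ − f + e) the node v is reachable only through f, and v is not a terminal, so δ − f + e
-- is again a multicut whenever δ is, and costs at least a f − a e > 0 less.  Hence every
-- multicut using f lies strictly above a·x = b.  As a ≥ 0 and every point of MultC dominates a
-- convex combination of multicuts, the facet lies in {x_f = 0}; having the right dimension, it
-- then contains all of MultC ∩ {x_f = 0}.  This forces a to vanish off f and b = 0, so the facet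
-- is x_f ≥ 0, which is excluded.  By symmetry a e = a f for consecutive edges, and a is constant
-- along the path.

module Submission where

open import Defs
open import Data.Nat using (ℕ; zero; suc)
open import Data.Fin using (Fin; zero; suc; inject₁; toℕ)
open import Data.Rational
  using (ℚ; 0ℚ; 1ℚ; _+_; _*_; _-_; -_; 1/_; _≤_; _<_; NonZero; ≢-nonZero; Positive; positive; nonNegative)
open import Data.Rational.Properties renaming (_≟_ to _≟ℚ_)
open import Data.Rational.Solver using (module +-*-Solver)
open import Algebra.Bundles using (Ring)
import Algebra.Properties.Semiring.Sum as SemiringSum
open import Relation.Binary.PropositionalEquality
open import Relation.Nullary using (¬_; Dec; yes; no; contradiction)
open import Data.Fin.Properties using (suc-injective; _≟_; toℕ-inject₁-≢)
open import Function using (_∘_)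
open import Data.Bool using (Bool; true; false)
open import Data.Sum using (_⊎_; inj₁; inj₂)
import Data.Sum as Sum
open import Data.List using (List; length; filter; allFin)
open import Data.List.Membership.Propositional using (_∈_)
open import Data.List.Membership.Propositional.Properties using (∈-filter⁺; ∈-allFin)
open import Data.List.Relation.Unary.Any using (here; there)
open import Relation.Nullary.Decidable using (_⊎-dec_)
open import Data.Vec.Functional using (_∷_)
open import Algebra.Properties.Group +-0-group using (x∙y⁻¹≈ε⇒x≈y; identityʳ-unique)
open import Data.Product using (_×_; _,_; proj₁; proj₂)
open import Function.Bundles using (mk⇔)

open +-*-Solver

p+r-r≡p : ∀ p r → p + r + - r ≡ p
p+r-r≡p = solve 2 (λ p r → p :+ r :+ :- r := p) refl

+-cancelʳ-≤ : ∀ {p q} r → p + r ≤ q + r → p ≤ q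
+-cancelʳ-≤ {p} {q} r p+r≤q+r = subst₂ _≤_ (p+r-r≡p p r) (p+r-r≡p q r) (+-monoˡ-≤ (- r) p+r≤q+r)

+-cancelˡ-≤ : ∀ {p q} r → r + p ≤ r + q → p ≤ q
+-cancelˡ-≤ {p} {q} r r+p≤r+q = +-cancelʳ-≤ r (subst₂ _≤_ (+-comm r p) (+-comm r q) r+p≤r+q)

+-cancelʳ-< : ∀ {p q} r → p + r < q + r → p < q
+-cancelʳ-< {p} {q} r p+r<q+r = subst₂ _<_ (p+r-r≡p p r) (p+r-r≡p q r) (+-monoˡ-< (- r) p+r<q+r)

0≤* : ∀ {p q} → 0ℚ ≤ p → 0ℚ ≤ q → 0ℚ ≤ p * q
0≤* {p} {q} 0≤p 0≤q = nonNegative⁻¹ _ {{nonNeg*nonNeg⇒nonNeg p {{nonNegative 0≤p}} q {{nonNegative 0≤q}}}}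

0≤q-p : ∀ {p q} → p ≤ q → 0ℚ ≤ q - p
0≤q-p {p} {q} p≤q = subst (_≤ q - p) (+-inverseʳ p) (+-monoˡ-≤ (- p) p≤q)

p≤p+q : ∀ {p q} → 0ℚ ≤ q → p ≤ p + q
p≤p+q {p} {q} 0≤q = subst (_≤ p + q) (+-identityʳ p) (+-monoʳ-≤ p 0≤q)

p*q≡0⇒p≡0 : ∀ {p q} → q ≢ 0ℚ → p * q ≡ 0ℚ → p ≡ 0ℚ
p*q≡0⇒p≡0 {p} {q} q≢0 pq≡0 = begin
  p                ≡⟨ *-identityʳ p ⟨
  p * 1ℚ           ≡⟨ cong (p *_) (*-inverseʳ q) ⟨
  p * (q * 1/ q)   ≡⟨ *-assoc p q (1/ q) ⟨
  p * q * 1/ q     ≡⟨ cong (_* 1/ q) pq≡0 ⟩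
  0ℚ * 1/ q        ≡⟨ *-zeroˡ (1/ q) ⟩
  0ℚ               ∎
  where
  open ≡-Reasoning
  instance
    q-nonZero : NonZero q
    q-nonZero = ≢-nonZero q≢0

m*x+n*y≡0⇒m≡0 : ∀ {m n x y} → x ≢ y → m + n ≡ 0ℚ → m * x + n * y ≡ 0ℚ → m ≡ 0ℚ
m*x+n*y≡0⇒m≡0 {m} {n} {x} {y} x≢y m+n≡0 mx+ny≡0 = p*q≡0⇒p≡0 (x≢y ∘ x∙y⁻¹≈ε⇒x≈y x y) (begin
  m * (x - y)                 ≡⟨ solve 4 (λ m n x y → m :* (x :- y) := (m :* x :+ n :* y) :- (m :+ n) :* y) refl m n x y ⟩
  m * x + n * y - (m + n) * y  ≡⟨ cong₂ (λ u v → u - v * y) mx+ny≡0 m+n≡0 ⟩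
  0ℚ - 0ℚ * y                 ≡⟨ solve 1 (λ y → con 0ℚ :- con 0ℚ :* y := con 0ℚ) refl y ⟩
  0ℚ                          ∎)
  where open ≡-Reasoning

module Σ = SemiringSum (Ring.semiring +-*-ring)

sumℚ≡sum : ∀ {k} (f : Fin k → ℚ) → sumℚ f ≡ Σ.sum f
sumℚ≡sum {zero}  f = refl
sumℚ≡sum {suc k} f = cong (f zero +_) (sumℚ≡sum (λ i → f (suc i)))

sumℚ-cong : ∀ {k} {f g : Fin k → ℚ} → (∀ i → f i ≡ g i) → sumℚ f ≡ sumℚ g
sumℚ-cong {f = f} {g} f≗g = trans (sumℚ≡sum f) (trans (Σ.sum-cong-≗ f≗g) (sym (sumℚ≡sum g)))

sumℚ-zero : ∀ k → sumℚ {k} (λ _ → 0ℚ) ≡ 0ℚ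
sumℚ-zero k = trans (sumℚ≡sum {k} (λ _ → 0ℚ)) (Σ.sum-replicate-zero k)

sumℚ-+ : ∀ {k} (f g : Fin k → ℚ) → sumℚ (λ i → f i + g i) ≡ sumℚ f + sumℚ g
sumℚ-+ f g = trans (sumℚ≡sum (λ i → f i + g i))
  (trans (Σ.∑-distrib-+ f g) (sym (cong₂ _+_ (sumℚ≡sum f) (sumℚ≡sum g))))

sumℚ-*ˡ : ∀ {k} c (f : Fin k → ℚ) → sumℚ (λ i → c * f i) ≡ c * sumℚ f
sumℚ-*ˡ c f = trans (sumℚ≡sum (λ i → c * f i)) (trans (sym (Σ.*-distribˡ-sum c f)) (cong (c *_) (sym (sumℚ≡sum f))))

sumℚ-*ʳ : ∀ {k} c (f : Fin k → ℚ) → sumℚ (λ i → f i * c) ≡ sumℚ f * c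
sumℚ-*ʳ c f = trans (sumℚ≡sum (λ i → f i * c)) (trans (sym (Σ.*-distribʳ-sum c f)) (cong (_* c) (sym (sumℚ≡sum f))))

sumℚ-comm : ∀ {k l} (h : Fin k → Fin l → ℚ) →
            sumℚ (λ i → sumℚ (λ j → h i j)) ≡ sumℚ (λ j → sumℚ (λ i → h i j))
sumℚ-comm h = begin
  sumℚ (λ i → sumℚ (h i))              ≡⟨ sumℚ-cong (λ i → sumℚ≡sum (h i)) ⟩
  sumℚ (λ i → Σ.sum (h i))             ≡⟨ sumℚ≡sum (λ i → Σ.sum (h i)) ⟩
  Σ.sum (λ i → Σ.sum (h i))            ≡⟨ Σ.∑-comm h ⟩
  Σ.sum (λ j → Σ.sum (λ i → h i j))    ≡⟨ sumℚ≡sum (λ j → Σ.sum (λ i → h i j)) ⟨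
  sumℚ (λ j → Σ.sum (λ i → h i j))     ≡⟨ sumℚ-cong (λ j → sumℚ≡sum (λ i → h i j)) ⟨
  sumℚ (λ j → sumℚ (λ i → h i j))      ∎
  where open ≡-Reasoning

sumℚ-single : ∀ {k} {f : Fin k → ℚ} j → (∀ i → i ≢ j → f i ≡ 0ℚ) → sumℚ f ≡ f j
sumℚ-single {suc k} {f} zero others = begin
  f zero + sumℚ (λ i → f (suc i))  ≡⟨ cong (f zero +_) (trans (sumℚ-cong (λ i → others (suc i) λ ())) (sumℚ-zero k)) ⟩
  f zero + 0ℚ                      ≡⟨ +-identityʳ (f zero) ⟩
  f zero                           ∎
  where open ≡-Reasoning
sumℚ-single {suc k} {f} (suc j) others = begin
  f zero + sumℚ (λ i → f (suc i))
    ≡⟨ cong₂ _+_ (others zero λ ()) (sumℚ-single j λ i i≢j → others (suc i) (i≢j ∘ suc-injective)) ⟩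
  0ℚ + f (suc j)                   ≡⟨ +-identityˡ (f (suc j)) ⟩
  f (suc j)                        ∎
  where open ≡-Reasoning

sumℚ-mono : ∀ {k} {f g : Fin k → ℚ} → (∀ i → f i ≤ g i) → sumℚ f ≤ sumℚ g
sumℚ-mono {zero}  f≤g = ≤-refl
sumℚ-mono {suc k} f≤g = +-mono-≤ (f≤g zero) (sumℚ-mono (λ i → f≤g (suc i)))

sumℚ-tight : ∀ {k} {f g : Fin k → ℚ} → (∀ i → f i ≤ g i) → sumℚ g ≤ sumℚ f → ∀ i → f i ≡ g i
sumℚ-tight {suc k} {f} {g} f≤g Σg≤Σf zero = ≤-antisym (f≤g zero) (+-cancelʳ-≤ (sumℚ f′) (begin
  g zero + sumℚ f′  ≤⟨ +-monoʳ-≤ (g zero) (sumℚ-mono (λ i → f≤g (suc i))) ⟩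
  g zero + sumℚ g′  ≤⟨ Σg≤Σf ⟩
  f zero + sumℚ f′  ∎))
  where
  open ≤-Reasoning
  f′ = λ i → f (suc i)
  g′ = λ i → g (suc i)
sumℚ-tight {suc k} {f} {g} f≤g Σg≤Σf (suc i) = sumℚ-tight (λ i → f≤g (suc i)) (+-cancelˡ-≤ (g zero) (begin
  g zero + sumℚ g′  ≤⟨ Σg≤Σf ⟩
  f zero + sumℚ f′  ≤⟨ +-monoˡ-≤ (sumℚ f′) (f≤g zero) ⟩
  g zero + sumℚ f′  ∎)) i
  where
  open ≤-Reasoning
  f′ = λ i → f (suc i)
  g′ = λ i → g (suc i)

∈-length≡2 : ∀ {A : Set} {xs : List A} {x y z} → length xs ≡ 2 →
             x ∈ xs → y ∈ xs → x ≢ y → z ∈ xs → z ≡ x ⊎ z ≡ y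
∈-length≡2 {xs = _ List.∷ _ List.∷ List.[]} refl (here refl) (here refl) x≢y _ = contradiction refl x≢y
∈-length≡2 {xs = _ List.∷ _ List.∷ List.[]} refl (here refl) (there (here refl)) _ (here refl) = inj₁ refl
∈-length≡2 {xs = _ List.∷ _ List.∷ List.[]} refl (here refl) (there (here refl)) _ (there (here refl)) = inj₂ refl
∈-length≡2 {xs = _ List.∷ _ List.∷ List.[]} refl (there (here refl)) (here refl) _ (here refl) = inj₂ refl
∈-length≡2 {xs = _ List.∷ _ List.∷ List.[]} refl (there (here refl)) (here refl) _ (there (here refl)) = inj₁ refl
∈-length≡2 {xs = _ List.∷ _ List.∷ List.[]} refl (there (here refl)) (there (here refl)) x≢y _ = contradiction refl x≢y

steps⇒≡zero : ∀ {A : Set} {n} (h : Fin (suc n) → A) → (∀ {i j} → suc i ≡ inject₁ j → h i ≡ h j) →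
              ∀ i → h i ≡ h zero
steps⇒≡zero h next zero          = refl
steps⇒≡zero h next (suc zero)    = sym (next {zero} {suc zero} refl)
steps⇒≡zero h next (suc (suc i)) =
  trans (steps⇒≡zero (h ∘ suc) (next ∘ cong suc) (suc i)) (sym (next {zero} {suc zero} refl))

steps⇒constant : ∀ {A : Set} {n} (h : Fin n → A) → (∀ {i j} → suc i ≡ inject₁ j → h i ≡ h j) →
                 ∀ i j → h i ≡ h j
steps⇒constant {n = suc _} h next i j = trans (steps⇒≡zero h next i) (sym (steps⇒≡zero h next j))

single : ∀ {d} → Fin d → ℚ → Fin d → ℚ
single j c g with g ≟ j
... | yes _ = c
... | no  _ = 0ℚ

single-≡ : ∀ {d} (j : Fin d) c → single j c j ≡ c
single-≡ j c with j ≟ j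
... | yes _   = refl
... | no  j≢j = contradiction refl j≢j

single-≢ : ∀ {d} {j g : Fin d} c → g ≢ j → single j c g ≡ 0ℚ
single-≢ {j = j} {g} c g≢j with g ≟ j
... | yes g≡j = contradiction g≡j g≢j
... | no  _   = refl

single-nonNeg : ∀ {d} (j : Fin d) {c} → 0ℚ ≤ c → ∀ g → 0ℚ ≤ single j c g
single-nonNeg j {c} 0≤c g with g ≟ j
... | yes _ = 0≤c
... | no  _ = ≤-refl

module _ {d : ℕ} (a : Fin d → ℚ) where

  dot-supported : ∀ f → (∀ g → g ≢ f → a g ≡ 0ℚ) → ∀ x → dot a x ≡ a f * x f
  dot-supported f a≡0 x = sumℚ-single f (λ g g≢f → trans (cong (_* x g) (a≡0 g g≢f)) (*-zeroˡ (x g)))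

  dot-+ : ∀ x y → dot a (λ g → x g + y g) ≡ dot a x + dot a y
  dot-+ x y = trans (sumℚ-cong (λ g → *-distribˡ-+ (a g) (x g) (y g)))
                    (sumℚ-+ (λ g → a g * x g) (λ g → a g * y g))

  dot-single : ∀ j c → dot a (single j c) ≡ a j * c
  dot-single j c = trans (dot-supported′) (cong (a j *_) (single-≡ j c))
    where
    dot-supported′ : dot a (single j c) ≡ a j * single j c j
    dot-supported′ = sumℚ-single j (λ g g≢j → trans (cong (a g *_) (single-≢ c g≢j)) (*-zeroʳ (a g)))

  dot-+single : ∀ x j c → dot a (λ g → x g + single j c g) ≡ dot a x + a j * c
  dot-+single x j c = trans (dot-+ x (single j c)) (cong (dot a x +_) (dot-single j c))

  dot-mono : (∀ g → 0ℚ ≤ a g) → ∀ {x y} → (∀ g → x g ≤ y g) → dot a x ≤ dot a y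
  dot-mono 0≤a x≤y = sumℚ-mono (λ g → *-monoˡ-≤-nonNeg (a g) {{nonNegative (0≤a g)}} (x≤y g))

  dot-combination : ∀ {k} (μ : Fin k → ℚ) (q : Fin k → Fin d → ℚ) →
                    dot a (λ g → sumℚ (λ i → μ i * q i g)) ≡ sumℚ (λ i → μ i * dot a (q i))
  dot-combination μ q = begin
    sumℚ (λ g → a g * sumℚ (λ i → μ i * q i g))    ≡⟨ sumℚ-cong (λ g → sumℚ-*ˡ (a g) (λ i → μ i * q i g)) ⟨
    sumℚ (λ g → sumℚ (λ i → a g * (μ i * q i g)))  ≡⟨ sumℚ-comm (λ g i → a g * (μ i * q i g)) ⟩
    sumℚ (λ i → sumℚ (λ g → a g * (μ i * q i g)))  ≡⟨ sumℚ-cong (λ i → sumℚ-cong (λ g → swap (a g) (μ i) (q i g))) ⟩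
    sumℚ (λ i → sumℚ (λ g → μ i * (a g * q i g)))  ≡⟨ sumℚ-cong (λ i → sumℚ-*ˡ (μ i) (λ g → a g * q i g)) ⟩
    sumℚ (λ i → μ i * dot a (q i))                 ∎
    where
    open ≡-Reasoning
    swap : ∀ x y z → x * (y * z) ≡ y * (x * z)
    swap = solve 3 (λ x y z → x :* (y :* z) := y :* (x :* z)) refl

UpClosed : ∀ {d} → ((Fin d → ℚ) → Set) → Set
UpClosed P = ∀ {x y} → P x → (∀ g → x g ≤ y g) → P y

module _ {d : ℕ} {P : (Fin d → ℚ) → Set} (up : UpClosed P) where

  upClosed-+single : ∀ {x} → P x → ∀ j {c} → 0ℚ ≤ c → P (λ g → x g + single j c g)
  upClosed-+single Px j 0≤c = up Px (λ g → p≤p+q (single-nonNeg j 0≤c g))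

  -- If a g < 0, moving x along g by t = (a·x − b + 1)/(−a g) brings a·x down to b − 1.
  valid⇒coeffs-nonNeg : ∀ {a b x} → P x → Valid P a b → ∀ g → 0ℚ ≤ a g
  valid⇒coeffs-nonNeg {a} {b} {x} Px valid g = ≮⇒≥ ag≮0
    where
    ag≮0 : ¬ a g < 0ℚ
    ag≮0 ag<0 = <-irrefl refl (≤-<-trans (valid y Py) ay<b)
      where
      c = - a g
      instance
        c-pos : Positive c
        c-pos = positive (neg-antimono-< ag<0)
        c-nonZero : NonZero c
        c-nonZero = pos⇒nonZero c
      gap = dot a x - b
      t = (gap + 1ℚ) * 1/ c
      0≤t : 0ℚ ≤ t
      0≤t = 0≤* (≤-trans (0≤q-p (valid x Px)) (p≤p+q (nonNegative⁻¹ 1ℚ))) (<⇒≤ (positive⁻¹ (1/ c) {{1/pos⇒pos c}}))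
      y = λ h → x h + single g t h
      Py : P y
      Py = upClosed-+single Px g 0≤t
      agt : a g * t ≡ - (gap + 1ℚ)
      agt = begin
        a g * ((gap + 1ℚ) * 1/ c)
          ≡⟨ solve 3 (λ α s ι → α :* (s :* ι) := :- (s :* ((:- α) :* ι))) refl (a g) (gap + 1ℚ) (1/ c) ⟩
        - ((gap + 1ℚ) * (c * 1/ c))   ≡⟨ cong (λ z → - ((gap + 1ℚ) * z)) (*-inverseʳ c) ⟩
        - ((gap + 1ℚ) * 1ℚ)           ≡⟨ cong -_ (*-identityʳ (gap + 1ℚ)) ⟩
        - (gap + 1ℚ)                  ∎
        where open ≡-Reasoning
      ay<b : dot a y < b
      ay<b = begin-strict
        dot a y                       ≡⟨ dot-+single a x g t ⟩
        dot a x + a g * t             ≡⟨ cong (dot a x +_) agt ⟩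
        dot a x + - (dot a x - b + 1ℚ)
          ≡⟨ solve 2 (λ A β → A :+ :- (A :- β :+ con 1ℚ) := β :+ con (- 1ℚ)) refl (dot a x) b ⟩
        b + - 1ℚ                      <⟨ +-monoʳ-< b (negative⁻¹ (- 1ℚ)) ⟩
        b + 0ℚ                        ≡⟨ +-identityʳ b ⟩
        b                             ∎
        where open ≤-Reasoning

module _ {d : ℕ} (a : Fin d → ℚ) (b : ℚ) (f : Fin d) where

  -- Coordinate f kills the weight of z, then a·x − b kills the weight of y.
  ∷-affinelyIndependent : ∀ {k} {p : Fin k → Fin d → ℚ} {z y : Fin d → ℚ} →
    AffinelyIndependent p → (∀ i → dot a (p i) ≡ b) → (∀ i → p i f ≡ 0ℚ) →
    z f ≢ 0ℚ → y f ≡ 0ℚ → dot a y ≢ b → AffinelyIndependent (z ∷ y ∷ p)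
  ∷-affinelyIndependent {k} {p} {z} {y} indep ap≡b pf≡0 zf≢0 yf≡0 ay≢b μ Σμ≡0 Σμq≡0 = μ≡0
    where
    μ₀ = μ zero
    μ₁ = μ (suc zero)
    μ′ = λ i → μ (suc (suc i))
    T  = sumℚ μ′
    Σμ′p : Fin d → ℚ
    Σμ′p g = sumℚ (λ i → μ′ i * p i g)
    Σμ′pf≡0 : Σμ′p f ≡ 0ℚ
    Σμ′pf≡0 = trans (sumℚ-cong (λ i → trans (cong (μ′ i *_) (pf≡0 i)) (*-zeroʳ (μ′ i)))) (sumℚ-zero k)
    0*x+y≡y : ∀ x y → 0ℚ * x + y ≡ y
    0*x+y≡y x y = trans (cong (_+ y) (*-zeroˡ x)) (+-identityˡ y)
    μ₀≡0 : μ₀ ≡ 0ℚ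
    μ₀≡0 = p*q≡0⇒p≡0 zf≢0 (begin
      μ₀ * z f                        ≡⟨ solve 2 (λ x m → x := x :+ (m :* con 0ℚ :+ con 0ℚ)) refl (μ₀ * z f) μ₁ ⟩
      μ₀ * z f + (μ₁ * 0ℚ + 0ℚ)       ≡⟨ cong₂ (λ u v → μ₀ * z f + (μ₁ * u + v)) yf≡0 Σμ′pf≡0 ⟨
      μ₀ * z f + (μ₁ * y f + Σμ′p f)  ≡⟨ Σμq≡0 f ⟩
      0ℚ                              ∎)
      where open ≡-Reasoning
    μ₁+T≡0 : μ₁ + T ≡ 0ℚ
    μ₁+T≡0 = trans (sym (trans (cong (_+ (μ₁ + T)) μ₀≡0) (+-identityˡ (μ₁ + T)))) Σμ≡0
    μ₁ay+Tb≡0 : μ₁ * dot a y + T * b ≡ 0ℚ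
    μ₁ay+Tb≡0 = begin
      μ₁ * dot a y + T * b
        ≡⟨ 0*x+y≡y (dot a z) (μ₁ * dot a y + T * b) ⟨
      0ℚ * dot a z + (μ₁ * dot a y + T * b)
        ≡⟨ cong₂ (λ u v → u * dot a z + (μ₁ * dot a y + v)) μ₀≡0 Σμ′ap≡Tb ⟨
      μ₀ * dot a z + (μ₁ * dot a y + sumℚ (λ i → μ′ i * dot a (p i)))
        ≡⟨ dot-combination a μ (z ∷ y ∷ p) ⟨
      dot a (λ g → μ₀ * z g + (μ₁ * y g + Σμ′p g))
        ≡⟨ sumℚ-cong (λ g → trans (cong (a g *_) (Σμq≡0 g)) (*-zeroʳ (a g))) ⟩
      sumℚ {d} (λ _ → 0ℚ)
        ≡⟨ sumℚ-zero d ⟩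
      0ℚ ∎
      where
      open ≡-Reasoning
      Σμ′ap≡Tb : sumℚ (λ i → μ′ i * dot a (p i)) ≡ T * b
      Σμ′ap≡Tb = trans (sumℚ-cong (λ i → cong (μ′ i *_) (ap≡b i))) (sumℚ-*ʳ b μ′)
    μ₁≡0 : μ₁ ≡ 0ℚ
    μ₁≡0 = m*x+n*y≡0⇒m≡0 ay≢b μ₁+T≡0 μ₁ay+Tb≡0
    T≡0 : T ≡ 0ℚ
    T≡0 = trans (sym (+-identityˡ T)) (trans (cong (_+ T) (sym μ₁≡0)) μ₁+T≡0)
    μ′≡0 : ∀ i → μ′ i ≡ 0ℚ
    μ′≡0 = indep μ′ T≡0 λ g → begin
      Σμ′p g                          ≡⟨ trans (0*x+y≡y (z g) _) (0*x+y≡y (y g) _) ⟨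
      0ℚ * z g + (0ℚ * y g + Σμ′p g)  ≡⟨ cong₂ (λ u v → u * z g + (v * y g + Σμ′p g)) μ₀≡0 μ₁≡0 ⟨
      μ₀ * z g + (μ₁ * y g + Σμ′p g)  ≡⟨ Σμq≡0 g ⟩
      0ℚ                              ∎
      where open ≡-Reasoning
    μ≡0 : ∀ i → μ i ≡ 0ℚ
    μ≡0 zero          = μ₀≡0
    μ≡0 (suc zero)    = μ₁≡0
    μ≡0 (suc (suc i)) = μ′≡0 i

module _ {d : ℕ} {P : (Fin d → ℚ) → Set} {a : Fin d → ℚ} {b : ℚ} {f : Fin d} where

  -- Otherwise z, y and the face's points would give dim P + 2 affinely independent points of P.
  coordinateSection⊆face : ∀ {k z} → ¬ HasAffIndep P (suc (suc k)) → HasAffIndep (Face P a b) k →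
    (∀ x → Face P a b x → x f ≡ 0ℚ) → P z → z f ≢ 0ℚ →
    ∀ {y} → P y → y f ≡ 0ℚ → dot a y ≡ b
  coordinateSection⊆face {z = z} noIndep (p , Fp , indep) F⊆xf≡0 Pz zf≢0 {y} Py yf≡0
    with dot a y ≟ℚ b
  ... | yes ay≡b = ay≡b
  ... | no  ay≢b = contradiction (z ∷ y ∷ p , Pq , extended) noIndep
    where
    Pq : ∀ i → P ((z ∷ y ∷ p) i)
    Pq zero          = Pz
    Pq (suc zero)    = Py
    Pq (suc (suc i)) = proj₁ (Fp i)
    extended = ∷-affinelyIndependent a b f indep (proj₂ ∘ Fp) (λ i → F⊆xf≡0 (p i) (Fp i)) zf≢0 yf≡0 ay≢b

  -- Moving a point of P ∩ {x_f = 0} along any other coordinate g shows a g = 0.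
  coordinateSection⊆hyperplane⇒nonNeg : UpClosed P → ∀ {y₀} → P y₀ → y₀ f ≡ 0ℚ →
    (∀ {y} → P y → y f ≡ 0ℚ → dot a y ≡ b) → 0ℚ < a f → SameAsNonneg a b f
  coordinateSection⊆hyperplane⇒nonNeg up {y₀} Py₀ y₀f≡0 section⊆H 0<af x =
    mk⇔ (λ b≤ax → *-cancelˡ-≤-pos (a f) (subst₂ _≤_ b≡af*0 (ax≡af*xf x) b≤ax))
        (λ 0≤xf → subst₂ _≤_ (sym b≡af*0) (sym (ax≡af*xf x)) (*-monoˡ-≤-nonNeg (a f) {{pos⇒nonNeg (a f)}} 0≤xf))
    where
    instance
      af-pos : Positive (a f)
      af-pos = positive 0<af
    ag≡0 : ∀ g → g ≢ f → a g ≡ 0ℚ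
    ag≡0 g g≢f = trans (sym (*-identityʳ (a g))) (identityʳ-unique (dot a y₀) (a g * 1ℚ) (begin
      dot a y₀ + a g * 1ℚ  ≡⟨ dot-+single a y₀ g 1ℚ ⟨
      dot a y₁             ≡⟨ section⊆H Py₁ y₁f≡0 ⟩
      b                    ≡⟨ section⊆H Py₀ y₀f≡0 ⟨
      dot a y₀             ∎))
      where
      open ≡-Reasoning
      y₁ = λ h → y₀ h + single g 1ℚ h
      Py₁ : P y₁
      Py₁ = upClosed-+single up Py₀ g (nonNegative⁻¹ 1ℚ)
      y₁f≡0 : y₁ f ≡ 0ℚ
      y₁f≡0 = trans (cong₂ _+_ y₀f≡0 (single-≢ 1ℚ (g≢f ∘ sym))) (+-identityʳ 0ℚ)
    ax≡af*xf : ∀ x → dot a x ≡ a f * x f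
    ax≡af*xf = dot-supported a f ag≡0
    b≡af*0 : b ≡ a f * 0ℚ
    b≡af*0 = trans (sym (section⊆H Py₀ y₀f≡0)) (trans (ax≡af*xf y₀) (cong (a f *_) y₀f≡0))

incidence-true : ∀ {k} (F : Fin k → Bool) {g} → F g ≡ true → incidence F g ≡ 1ℚ
incidence-true F {g} Fg≡true with F g
... | true = refl

incidence-false : ∀ {k} (F : Fin k → Bool) {g} → F g ≡ false → incidence F g ≡ 0ℚ
incidence-false F {g} Fg≡false with F g
... | false = refl

incidence-nonNeg : ∀ {k} (F : Fin k → Bool) g → 0ℚ ≤ incidence F g
incidence-nonNeg F g with F g
... | true  = nonNegative⁻¹ 1ℚ
... | false = ≤-refl

module _ (G : Graph) (S : TerminalPairs G) where

  multC-upClosed : UpClosed (InMultC G S)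
  multC-upClosed (k , λs , δs , 0≤λ , Σλ≡1 , multicut , comb≤x) x≤y =
    k , λs , δs , 0≤λ , Σλ≡1 , multicut , λ g → ≤-trans (comb≤x g) (x≤y g)

  multicut∈multC : ∀ {δ} → IsMulticut G S δ → InMultC G S (incidence δ)
  multicut∈multC {δ} multicut =
    1 , (λ _ → 1ℚ) , (λ _ → δ) , (λ _ → nonNegative⁻¹ 1ℚ) , +-identityʳ 1ℚ , (λ _ → multicut) , λ g → ≤-reflexive (trans (+-identityʳ (1ℚ * incidence δ g)) (*-identityˡ (incidence δ g)))

  all-isMulticut : IsMulticut G S (λ _ → true)
  all-isMulticut ((s , t) , s≢t) _ = s≢t ∘ isolated
    where
    isolated : ∀ {u v} → Connected G (λ _ → true) u v → u ≡ v
    isolated here               = refl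
    isolated (step _ () _ _)

  -- A tight point of MultC dominates a convex combination of multicuts; tightness forces all of
  -- its weight onto tight multicuts and forces the point to agree with the combination where a > 0.
  face⇒coord≡0 : ∀ {a b f} → Valid (InMultC G S) a b → (∀ g → 0ℚ ≤ a g) → 0ℚ < a f →
    (∀ δ → IsMulticut G S δ → δ f ≡ true → b < dot a (incidence δ)) →
    ∀ x → Face (InMultC G S) a b x → x f ≡ 0ℚ
  face⇒coord≡0 {a} {b} {f} valid 0≤a 0<af loose x ((k , λs , δs , 0≤λ , Σλ≡1 , multicut , w≤x) , ax≡b) =
    trans (sym wf≡xf) wf≡0
    where
    instance
      af-pos : Positive (a f)
      af-pos = positive 0<af
    χ : Fin k → Fin (m G) → ℚ
    χ i = incidence (δs i)
    w : Fin (m G) → ℚ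
    w g = sumℚ (λ i → λs i * χ i g)
    λb≤λaχ : ∀ i → λs i * b ≤ λs i * dot a (χ i)
    λb≤λaχ i = *-monoˡ-≤-nonNeg (λs i) {{nonNegative (0≤λ i)}} (valid (χ i) (multicut∈multC (multicut i)))
    Σλb≡b : sumℚ (λ i → λs i * b) ≡ b
    Σλb≡b = trans (sumℚ-*ʳ b λs) (trans (cong (_* b) Σλ≡1) (*-identityˡ b))
    aw≡Σλaχ : dot a w ≡ sumℚ (λ i → λs i * dot a (χ i))
    aw≡Σλaχ = dot-combination a λs χ
    aw≤ax : dot a w ≤ dot a x
    aw≤ax = dot-mono a 0≤a w≤x
    λb≡λaχ : ∀ i → λs i * b ≡ λs i * dot a (χ i)
    λb≡λaχ = sumℚ-tight λb≤λaχ (subst₂ _≤_ aw≡Σλaχ (trans ax≡b (sym Σλb≡b)) aw≤ax)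
    ax≤aw : dot a x ≤ dot a w
    ax≤aw = subst₂ _≤_ (trans Σλb≡b (sym ax≡b)) (sym aw≡Σλaχ) (sumℚ-mono λb≤λaχ)
    awf≡axf : a f * w f ≡ a f * x f
    awf≡axf = sumℚ-tight (λ g → *-monoˡ-≤-nonNeg (a g) {{nonNegative (0≤a g)}} (w≤x g)) ax≤aw f
    wf≡xf : w f ≡ x f
    wf≡xf = ≤-antisym (*-cancelˡ-≤-pos (a f) (≤-reflexive awf≡axf))
                      (*-cancelˡ-≤-pos (a f) (≤-reflexive (sym awf≡axf)))
    loose⇒λ≡0 : ∀ i → δs i f ≡ true → λs i ≡ 0ℚ
    loose⇒λ≡0 i δf≡true = ≤-antisym (≮⇒≥ λ 0<λ → <-irrefl (λb≡λaχ i)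
      (*-monoʳ-<-pos (λs i) {{positive 0<λ}} (loose (δs i) (multicut i) δf≡true))) (0≤λ i)
    λχf≡0 : ∀ i → λs i * χ i f ≡ 0ℚ
    λχf≡0 i with δs i f in δf
    ... | true  = trans (cong (_* 1ℚ) (loose⇒λ≡0 i δf)) (*-zeroˡ 1ℚ)
    ... | false = *-zeroʳ (λs i)
    wf≡0 : w f ≡ 0ℚ
    wf≡0 = trans (sumℚ-cong λχf≡0) (sumℚ-zero k)

module Adjacency (G : Graph) where

  Incident : Fin (m G) → Fin (n G) → Set
  Incident g v = src G g ≡ v ⊎ tgt G g ≡ v

  joins-incidentˡ : ∀ {g u v} → Joins G g u v → Incident g u
  joins-incidentˡ (inj₁ (src≡u , _)) = inj₁ src≡u
  joins-incidentˡ (inj₂ (_ , tgt≡u)) = inj₂ tgt≡u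

  joins-sym : ∀ {g u v} → Joins G g u v → Joins G g v u
  joins-sym = Sum.swap

  joins-incidentʳ : ∀ {g u v} → Joins G g u v → Incident g v
  joins-incidentʳ = joins-incidentˡ ∘ joins-sym

  joins-≢ : ∀ {g u v} → Joins G g u v → u ≢ v
  joins-≢ {g} (inj₁ (src≡u , tgt≡v)) u≡v = noLoop G g (trans src≡u (trans u≡v (sym tgt≡v)))
  joins-≢ {g} (inj₂ (src≡v , tgt≡u)) u≡v = noLoop G g (trans src≡v (trans (sym u≡v) (sym tgt≡u)))

  joins-≡ : ∀ {g u v u′ v′} → Joins G g u v → Joins G g u′ v′ → (u ≡ u′ × v ≡ v′) ⊎ (u ≡ v′ × v ≡ u′)
  joins-≡ (inj₁ (s≡u , t≡v)) (inj₁ (s≡u′ , t≡v′)) = inj₁ (trans (sym s≡u) s≡u′ , trans (sym t≡v) t≡v′)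
  joins-≡ (inj₁ (s≡u , t≡v)) (inj₂ (s≡v′ , t≡u′)) = inj₂ (trans (sym s≡u) s≡v′ , trans (sym t≡v) t≡u′)
  joins-≡ (inj₂ (s≡v , t≡u)) (inj₁ (s≡u′ , t≡v′)) = inj₂ (trans (sym t≡u) t≡v′ , trans (sym s≡v) s≡u′)
  joins-≡ (inj₂ (s≡v , t≡u)) (inj₂ (s≡v′ , t≡u′)) = inj₁ (trans (sym t≡u) t≡u′ , trans (sym s≡v) s≡v′)

  degree≡2⇒incident-either : ∀ {v e f} → degree G v ≡ 2 → e ≢ f → Incident e v → Incident f v →
                             ∀ g → Incident g v → g ≡ e ⊎ g ≡ f
  degree≡2⇒incident-either {v} deg≡2 e≢f e∼v f∼v g g∼v =
    ∈-length≡2 deg≡2 (incident∈ e∼v) (incident∈ f∼v) e≢f (incident∈ g∼v)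
    where
    incident∈ : ∀ {h} → Incident h v → h ∈ filter (λ h → (src G h ≟ v) ⊎-dec (tgt G h ≟ v)) (allFin (m G))
    incident∈ {h} = ∈-filter⁺ _ (∈-allFin h)

module Exchange {G : Graph} (e f : Fin (m G)) (e≢f : e ≢ f) where

  open Adjacency G

  exchange : EdgeSet G → EdgeSet G
  exchange δ g with g ≟ f | g ≟ e
  ... | yes _ | _     = false
  ... | no _  | yes _ = true
  ... | no _  | no _  = δ g

  exchange-f : ∀ δ → exchange δ f ≡ false
  exchange-f δ with f ≟ f
  ... | yes _   = refl
  ... | no  f≢f = contradiction refl f≢f

  exchange-e : ∀ δ → exchange δ e ≡ true
  exchange-e δ with e ≟ f | e ≟ e
  ... | yes e≡f | _       = contradiction e≡f e≢f
  ... | no _    | yes _   = refl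
  ... | no _    | no  e≢e = contradiction refl e≢e

  exchange-other : ∀ δ {g} → g ≢ f → g ≢ e → exchange δ g ≡ δ g
  exchange-other δ {g} g≢f g≢e with g ≟ f | g ≟ e
  ... | yes g≡f | _       = contradiction g≡f g≢f
  ... | no _    | yes g≡e = contradiction g≡e g≢e
  ... | no _    | no _    = refl

  exchange-false : ∀ δ {g} → exchange δ g ≡ false → g ≡ f ⊎ (g ≢ f × g ≢ e × δ g ≡ false)
  exchange-false δ {g} δ′g≡false with g ≟ f | g ≟ e
  ... | yes g≡f | _       = inj₁ g≡f
  ... | no _    | yes _   = contradiction δ′g≡false λ ()
  ... | no g≢f  | no g≢e  = inj₂ (g≢f , g≢e , δ′g≡false)

  exchange-incidence : ∀ δ → δ f ≡ true →
    ∀ g → incidence (exchange δ) g + single f 1ℚ g ≤ incidence δ g + single e 1ℚ g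
  exchange-incidence δ δf≡true g = pointwise (g ≟ f) (g ≟ e)
    where
    pointwise : Dec (g ≡ f) → Dec (g ≡ e) →
                incidence (exchange δ) g + single f 1ℚ g ≤ incidence δ g + single e 1ℚ g
    pointwise (yes refl) _ = ≤-reflexive (begin
      incidence (exchange δ) f + single f 1ℚ f  ≡⟨ cong₂ _+_ (incidence-false (exchange δ) {f} (exchange-f δ)) (single-≡ f 1ℚ) ⟩
      0ℚ + 1ℚ                                  ≡⟨ +-comm 0ℚ 1ℚ ⟩
      1ℚ + 0ℚ                                  ≡⟨ cong₂ _+_ (incidence-true δ δf≡true) (single-≢ 1ℚ (e≢f ∘ sym)) ⟨
      incidence δ f + single e 1ℚ f            ∎)
      where open ≡-Reasoning
    pointwise (no _) (yes refl) = begin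
      incidence (exchange δ) e + single f 1ℚ e  ≡⟨ cong₂ _+_ (incidence-true (exchange δ) {e} (exchange-e δ)) (single-≢ 1ℚ e≢f) ⟩
      1ℚ + 0ℚ                                  ≡⟨ +-comm 1ℚ 0ℚ ⟩
      0ℚ + 1ℚ                                  ≤⟨ +-monoˡ-≤ 1ℚ (incidence-nonNeg δ e) ⟩
      incidence δ e + 1ℚ                       ≡⟨ cong (incidence δ e +_) (single-≡ e 1ℚ) ⟨
      incidence δ e + single e 1ℚ e            ∎
      where open ≤-Reasoning
    pointwise (no g≢f) (no g≢e) = ≤-reflexive (cong₂ _+_
      (cong (λ b → incidence (λ _ → b) g) (exchange-other δ g≢f g≢e))
      (trans (single-≢ 1ℚ g≢f) (sym (single-≢ 1ℚ g≢e))))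

  exchange-cost : (a : Fin (m G) → ℚ) → (∀ g → 0ℚ ≤ a g) → ∀ δ → δ f ≡ true →
    dot a (incidence (exchange δ)) + a f ≤ dot a (incidence δ) + a e
  exchange-cost a 0≤a δ δf≡true = begin
    dot a (incidence (exchange δ)) + a f            ≡⟨ cong (dot a (incidence (exchange δ)) +_) (*-identityʳ (a f)) ⟨
    dot a (incidence (exchange δ)) + a f * 1ℚ       ≡⟨ dot-+single a (incidence (exchange δ)) f 1ℚ ⟨
    dot a (λ g → incidence (exchange δ) g + single f 1ℚ g)  ≤⟨ dot-mono a 0≤a (exchange-incidence δ δf≡true) ⟩
    dot a (λ g → incidence δ g + single e 1ℚ g)     ≡⟨ dot-+single a (incidence δ) e 1ℚ ⟩
    dot a (incidence δ) + a e * 1ℚ                  ≡⟨ cong (dot a (incidence δ) +_) (*-identityʳ (a e)) ⟩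
    dot a (incidence δ) + a e                       ∎
    where open ≤-Reasoning

  module _ {v w : Fin (n G)} (f-joins : Joins G f v w) (only : ∀ g → Incident g v → g ≡ e ⊎ g ≡ f) where

    ¬incident : ∀ {g} → g ≢ e → g ≢ f → ¬ Incident g v
    ¬incident g≢e g≢f g∼v = Sum.[ g≢e , g≢f ] (only _ g∼v)

    -- In G − (δ − f + e) a path enters v only through f, so it can be shortcut at w.
    reroute : ∀ δ {x t} → Connected G (exchange δ) x t → x ≢ v → t ≢ v → Connected G δ x t
    reroute-from-v : ∀ δ {t} → Connected G (exchange δ) v t → t ≢ v → Connected G δ w t

    reroute δ here _ _ = here
    reroute δ (step g δ′g≡false g-joins rest) x≢v t≢v with exchange-false δ δ′g≡false
    ... | inj₂ (g≢f , g≢e , δg≡false) =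
      step g δg≡false g-joins (reroute δ rest (λ y≡v → ¬incident g≢e g≢f (subst (Incident g) y≡v (joins-incidentʳ g-joins))) t≢v)
    ... | inj₁ refl with joins-≡ g-joins f-joins
    ...   | inj₁ (x≡v , _)     = contradiction x≡v x≢v
    ...   | inj₂ (refl , refl) = reroute-from-v δ rest t≢v

    reroute-from-v δ here t≢v = contradiction refl t≢v
    reroute-from-v δ (step g δ′g≡false g-joins rest) t≢v with exchange-false δ δ′g≡false
    ... | inj₂ (g≢f , g≢e , _) = contradiction (joins-incidentˡ g-joins) (¬incident g≢e g≢f)
    ... | inj₁ refl with joins-≡ g-joins f-joins
    ...   | inj₁ (_ , refl) = reroute δ rest (joins-≢ f-joins ∘ sym) t≢v
    ...   | inj₂ (v≡w , _)  = contradiction v≡w (joins-≢ f-joins)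

    exchange-isMulticut : ∀ {S} → ¬ IsTerminal G S v → ∀ {δ} → IsMulticut G S δ → IsMulticut G S (exchange δ)
    exchange-isMulticut v-nonTerminal multicut p p∈S connected =
      multicut p p∈S (reroute _ connected (λ s≡v → v-nonTerminal (p , p∈S , inj₁ s≡v))
                                          (λ t≡v → v-nonTerminal (p , p∈S , inj₂ t≡v)))

module _ {G : Graph} {S : TerminalPairs G} {a : Fin (m G) → ℚ} {b : ℚ} where

  open Adjacency G

  coeffs-nonNeg : Valid (InMultC G S) a b → ∀ g → 0ℚ ≤ a g
  coeffs-nonNeg = valid⇒coeffs-nonNeg (multC-upClosed G S) (multicut∈multC G S (all-isMulticut G S))

  exchangeable⇒¬< : FacetDefining (InMultC G S) a b → (∀ e′ → ¬ SameAsNonneg a b e′) →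
    ∀ {e f v w} → e ≢ f → Joins G f v w → (∀ g → Incident g v → g ≡ e ⊎ g ≡ f) → ¬ IsTerminal G S v →
    ¬ a e < a f
  exchangeable⇒¬< (valid , _ , (_ , noIndep) , (faceIndep , _)) nontrivial {e} {f}
                  e≢f f-joins only v-nonTerminal ae<af =
    nontrivial f (coordinateSection⊆hyperplane⇒nonNeg {a = a} {f = f} (multC-upClosed G S)
                    (∈multC (exchangeCut allCut)) (incidence-false (exchange all) {f} (exchange-f all))
                    section⊆face 0<af)
    where
    open Exchange e f e≢f
    0≤a = coeffs-nonNeg valid
    0<af = ≤-<-trans (0≤a e) ae<af
    all : EdgeSet G
    all _ = true
    allCut = all-isMulticut G S
    ∈multC = multicut∈multC G S
    exchangeCut = exchange-isMulticut f-joins only v-nonTerminal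
    loose : ∀ δ → IsMulticut G S δ → δ f ≡ true → b < dot a (incidence δ)
    loose δ multicut δf≡true = +-cancelʳ-< (a f) (begin-strict
      b + a f                               ≤⟨ +-monoˡ-≤ (a f) (valid _ (∈multC (exchangeCut multicut))) ⟩
      dot a (incidence (exchange δ)) + a f  ≤⟨ exchange-cost a 0≤a δ δf≡true ⟩
      dot a (incidence δ) + a e             <⟨ +-monoʳ-< (dot a (incidence δ)) ae<af ⟩
      dot a (incidence δ) + a f             ∎)
      where open ≤-Reasoning
    section⊆face = coordinateSection⊆face {a = a} {f = f} noIndep faceIndep
                     (face⇒coord≡0 G S valid 0≤a 0<af loose)
                     (∈multC allCut) (1≢0 ∘ trans (sym (incidence-true all {f} refl)))

  adjacent-coeffs-≡ : FacetDefining (InMultC G S) a b → (∀ e′ → ¬ SameAsNonneg a b e′) →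
    ∀ {e f u v w} → Joins G e u v → Joins G f v w → degree G v ≡ 2 → ¬ IsTerminal G S v → a e ≡ a f
  adjacent-coeffs-≡ facet nontrivial {e} {f} e-joins f-joins deg≡2 v-nonTerminal with e ≟ f
  ... | yes refl = refl
  ... | no e≢f   = ≤-antisym
    (≮⇒≥ (exchangeable⇒¬< facet nontrivial (e≢f ∘ sym) (joins-sym e-joins) (λ g → Sum.swap ∘ only g) v-nonTerminal))
    (≮⇒≥ (exchangeable⇒¬< facet nontrivial e≢f f-joins only v-nonTerminal))
    where
    only = degree≡2⇒incident-either deg≡2 e≢f (joins-incidentʳ e-joins) (joins-incidentˡ f-joins)

theorem3p4 : (G : Graph) (S : TerminalPairs G) (a : Fin (m G) → ℚ) (b : ℚ) →
    FacetDefining (InMultC G S) a b →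
    (∀ e' → ¬ SameAsNonneg a b e') →
    (P : Path G) →
    (∀ i → Internal P i → degree G (nodes P i) ≡ 2) →
    (∀ i → Internal P i → ¬ IsTerminal G S (nodes P i)) →
    ∀ i j → a (edges P i) ≡ a (edges P j)
theorem3p4 G S a b facet nontrivial P deg≡2 nonTerminal = steps⇒constant (a ∘ edges P) consecutive
  where
  consecutive : ∀ {i j} → suc i ≡ inject₁ j → a (edges P i) ≡ a (edges P j)
  consecutive {i} {j} suci≡j = adjacent-coeffs-≡ {a = a} facet nontrivial (edgeJoins P i) j-joins
    (deg≡2 (suc i) internal) (nonTerminal (suc i) internal)
    where
    j-joins : Joins G (edges P j) (nodes P (suc i)) (nodes P (suc j))
    j-joins = subst (λ v → Joins G (edges P j) v (nodes P (suc j))) (cong (nodes P) (sym suci≡j)) (edgeJoins P j)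
    internal : Internal P (suc i)
    internal = (λ ()) , λ suci≡len → toℕ-inject₁-≢ j (trans (sym suci≡len) (cong toℕ suci≡j))
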